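{- Let $\mathbf D=\langle D,+,',1\rangle$ be an algebra of type $(2,1,0)$, with $0:=1'$, satisfying the identities (a) $x''\approx x$; (b) $0+x\approx x$ and $x+1\approx 1$; (c) $x+x'\approx 1$; (e) $(((z+y)'+(z+x))'+(z+y)')+z'\approx z'$; (f) $x+(x+y)\approx x+y$ and $y+(x+y)\approx x+y$. Then $\mathbf D$ satisfies the quasi-identity "for all $x,z$: if $x+z=z$ and $x'+z=z$ then $z=1$" if and only if $\mathbf D$ satisfies the identity $1+x\approx 1$. -}

module Defs where

open import Level using (Level; suc)
open import Relation.Binary.PropositionalEquality using (_≡_)
open import Data.Product using (_×_)

record Algebra210 (a : Level) : Set (suc a) where
  field
    D   : Set a
    _⊕_ : D → D → D
    _′  : D → D
    𝟙   : D
  infixl 6 _⊕_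
  infix 8 _′

  𝟘 : D
  𝟘 = 𝟙 ′

record Axioms {a : Level} (A : Algebra210 a) : Set a where
  open Algebra210 A
  field
    ax-a  : ∀ x → (x ′) ′ ≡ x
    ax-b1 : ∀ x → 𝟘 ⊕ x ≡ x
    ax-b2 : ∀ x → x ⊕ 𝟙 ≡ 𝟙
    ax-c  : ∀ x → x ⊕ x ′ ≡ 𝟙
    ax-e  : ∀ x y z → (((z ⊕ y) ′ ⊕ (z ⊕ x)) ′ ⊕ (z ⊕ y) ′) ⊕ z ′ ≡ z ′
    ax-f1 : ∀ x y → x ⊕ (x ⊕ y) ≡ x ⊕ y
    ax-f2 : ∀ x y → y ⊕ (x ⊕ y) ≡ x ⊕ y

QuasiId : ∀ {a} → Algebra210 a → Set a
QuasiId A = ∀ x z → x ⊕ z ≡ z → x ′ ⊕ z ≡ z → z ≡ 𝟙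
  where open Algebra210 A

OneAbsorbsLeft : ∀ {a} → Algebra210 a → Set a
OneAbsorbsLeft A = ∀ x → 𝟙 ⊕ x ≡ 𝟙
  where open Algebra210 A

-- Direction (⇒): put x = 1 and z = 1 + x in the quasi-identity; both hypotheses are
-- instances of (f) and (b).  Direction (⇐): (e) gives (p + q)' + p' = p', so the two
-- hypotheses say that z' absorbs both x and x' from the left.  Instantiating (e) with
-- z' for z, x for y and x' for x, the left-hand side then collapses to 1 + z'', so
-- z = z'' = 1 + z'' = 1.
module Submission where

open import Defs
open import Level using (Level)
open import Data.Product using (_×_; _,_)
open import Relation.Binary.PropositionalEquality

module _ {a : Level} (A : Algebra210 a) (ax : Axioms A) where
  open Algebra210 A
  open Axioms ax
  open ≡-Reasoning

  ⊕-idem : ∀ y → y ⊕ y ≡ y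
  ⊕-idem y = begin
    y ⊕ y        ≡⟨ cong (y ⊕_) (sym (ax-b1 y)) ⟩
    y ⊕ (𝟘 ⊕ y)  ≡⟨ ax-f2 𝟘 y ⟩
    𝟘 ⊕ y        ≡⟨ ax-b1 y ⟩
    y            ∎

  -- (e) with x := p', once the 𝟘 hidden in (p + q)' = 𝟘 + (p + q)' is rewritten as
  -- ((p + q)' + (p + p'))'.
  [p⊕q]′⊕p′≡p′ : ∀ p q → (p ⊕ q) ′ ⊕ p ′ ≡ p ′
  [p⊕q]′⊕p′≡p′ p q = begin
    (p ⊕ q) ′ ⊕ p ′
      ≡⟨ cong (_⊕ p ′) (sym (ax-b1 ((p ⊕ q) ′))) ⟩
    (𝟘 ⊕ (p ⊕ q) ′) ⊕ p ′
      ≡⟨ cong (λ w → (w ′ ⊕ (p ⊕ q) ′) ⊕ p ′) (sym (ax-b2 ((p ⊕ q) ′))) ⟩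
    (((p ⊕ q) ′ ⊕ 𝟙) ′ ⊕ (p ⊕ q) ′) ⊕ p ′
      ≡⟨ cong (λ w → (((p ⊕ q) ′ ⊕ w) ′ ⊕ (p ⊕ q) ′) ⊕ p ′) (sym (ax-c p)) ⟩
    (((p ⊕ q) ′ ⊕ (p ⊕ p ′)) ′ ⊕ (p ⊕ q) ′) ⊕ p ′
      ≡⟨ ax-e (p ′) q p ⟩
    p ′ ∎

  ⊕-absorbed⇒′-absorbs : ∀ x z → x ⊕ z ≡ z → z ′ ⊕ x ′ ≡ x ′
  ⊕-absorbed⇒′-absorbs x z x⊕z≡z = begin
    z ′ ⊕ x ′        ≡⟨ cong (λ w → w ′ ⊕ x ′) (sym x⊕z≡z) ⟩
    (x ⊕ z) ′ ⊕ x ′  ≡⟨ [p⊕q]′⊕p′≡p′ x z ⟩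
    x ′              ∎

  ′-absorbs-both⇒𝟙⊕′ : ∀ w x → w ⊕ x ≡ x → w ⊕ x ′ ≡ x ′ → 𝟙 ⊕ w ′ ≡ w ′
  ′-absorbs-both⇒𝟙⊕′ w x w⊕x≡x w⊕x′≡x′ = begin
    𝟙 ⊕ w ′                                        ≡⟨ cong (_⊕ w ′) (sym (ax-c x)) ⟩
    (x ⊕ x ′) ⊕ w ′                                ≡⟨ cong (λ v → (v ⊕ x ′) ⊕ w ′) (sym (ax-a x)) ⟩
    (x ′ ′ ⊕ x ′) ⊕ w ′                            ≡⟨ cong (λ v → (v ′ ⊕ x ′) ⊕ w ′) (sym (⊕-idem (x ′))) ⟩
    ((x ′ ⊕ x ′) ′ ⊕ x ′) ⊕ w ′                    ≡⟨ cong₂ (λ u v → ((u ′ ⊕ v) ′ ⊕ u ′) ⊕ w ′) (sym w⊕x≡x) (sym w⊕x′≡x′) ⟩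
    (((w ⊕ x) ′ ⊕ (w ⊕ x ′)) ′ ⊕ (w ⊕ x) ′) ⊕ w ′  ≡⟨ ax-e (x ′) x w ⟩
    w ′                                            ∎

  quasiId⇒oneAbsorbsLeft : QuasiId A → OneAbsorbsLeft A
  quasiId⇒oneAbsorbsLeft quasiId x = quasiId 𝟙 (𝟙 ⊕ x) (ax-f1 𝟙 x) (ax-b1 (𝟙 ⊕ x))

  oneAbsorbsLeft⇒quasiId : OneAbsorbsLeft A → QuasiId A
  oneAbsorbsLeft⇒quasiId 𝟙⊕-≡𝟙 x z x⊕z≡z x′⊕z≡z = begin
    z         ≡⟨ sym (ax-a z) ⟩
    z ′ ′     ≡⟨ sym (′-absorbs-both⇒𝟙⊕′ (z ′) x z′⊕x≡x z′⊕x′≡x′) ⟩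
    𝟙 ⊕ z ′ ′ ≡⟨ 𝟙⊕-≡𝟙 (z ′ ′) ⟩
    𝟙         ∎
    where
    z′⊕x≡x : z ′ ⊕ x ≡ x
    z′⊕x≡x = subst (λ v → z ′ ⊕ v ≡ v) (ax-a x) (⊕-absorbed⇒′-absorbs (x ′) z x′⊕z≡z)

    z′⊕x′≡x′ : z ′ ⊕ x ′ ≡ x ′
    z′⊕x′≡x′ = ⊕-absorbed⇒′-absorbs x z x⊕z≡z

proposition2p8 : ∀ {a : Level} (A : Algebra210 a) → Axioms A →
    (QuasiId A → OneAbsorbsLeft A) × (OneAbsorbsLeft A → QuasiId A)
proposition2p8 A ax = quasiId⇒oneAbsorbsLeft A ax , oneAbsorbsLeft⇒quasiId A ax
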